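{- Let $n\ge1$ and $a,b,t$ be integers with $t\ge 1$ and $n>a+b-t$. Let $F\in\binom{[n]}{a}$ and $G\in\binom{[n]}{b}$, and let $\overline{G}=[n]\setminus G$. Then the following two conditions are equivalent: (a) there exists $s\in[n]$ such that $|F\cap[s]|+|G\cap[s]|\ge s+t$; (b) there exists $i\in[a-t+1]$ such that $m(\overline{G},i)>m(F,t+i-1)$.
   Context: $[k]=\{1,\dots,k\}$ (empty if $k\le 0$), and $\binom{[n]}{m}$ is the set of $m$-element subsets of $[n]$. For $X\subseteq[n]$ and $1\le i\le|X|$, $m(X,i)$ denotes the $i$-th smallest element of $X$. (Under the hypotheses, $|\overline{G}|=n-b\ge a-t+1$, so $m(\overline{G},i)$ is defined for $i\in[a-t+1]$.) -}

module Defs where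

open import Data.Nat using (ℕ; zero; suc; _<ᵇ_)
open import Data.Bool using (Bool; true; false)
open import Data.List using (List; []; _∷_; map)
open import Data.Vec using (Vec; []; _∷_; tabulate)
open import Data.Fin using (Fin; toℕ)
open import Data.Fin.Subset using (Subset)

-- Convention: a subset X ⊆ [n] = {1,…,n} is a  Subset n  (a Vec Bool n);
-- position k : Fin n represents the element  toℕ k + 1.

seg : (n s : ℕ) → Subset n
seg n s = tabulate (λ (k : Fin n) → toℕ k <ᵇ s)

elems : {n : ℕ} → Subset n → List ℕ
elems [] = []
elems (true ∷ v) = 1 ∷ map suc (elems v)
elems (false ∷ v) = map suc (elems v)

-- i-th entry (1-based) of a list, default 0 when out of range.
nth : List ℕ → ℕ → ℕ
nth [] _ = 0
nth (x ∷ xs) zero = 0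
nth (x ∷ xs) (suc zero) = x
nth (x ∷ xs) (suc (suc i)) = nth xs (suc i)

-- m(X,i): the i-th smallest element of X (only used for 1 ≤ i ≤ |X|).
m : {n : ℕ} → Subset n → ℕ → ℕ
m X i = nth (elems X) i

-- Write c_X(s) = |X ∩ [s]|. The i-th element of X is at most s exactly when
-- i ≤ c_X(s), and c_G(s) + c_{∁G}(s) = s, so condition (a) at s says
-- t + c_{∁G}(s) ≤ c_F(s). For (a) ⇒ (b) take i = c_{∁G}(s) + 1: the (t+i-1)-th
-- element of F is ≤ s, while the i-th element of ∁G is > s. For (b) ⇒ (a) take
-- s = m(F, t+i-1): then c_F(s) = t+i-1 and c_{∁G}(s) ≤ i-1.
module Submission where

open import Defs
open import Data.Nat using (ℕ; zero; suc; _+_; _∸_; _≤_; _<_; _≥_; _>_; z≤n; s≤s; _≤?_)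
open import Data.Nat.Properties
open import Data.Nat.Tactic.RingSolver using (solve-∀)
open import Data.Product using (_×_; ∃-syntax; _,_)
open import Data.Fin.Subset using (Subset; ∣_∣; _∩_; ∁)
open import Data.Fin.Subset.Properties using (∣p∩q∣≤∣p∣; ∣∁p∣≡n∸∣p∣)
open import Data.Bool using (true; false)
open import Data.Vec using ([]; _∷_)
open import Data.List using (List; _∷_; map; length)
open import Data.List.Properties using (length-map)
open import Relation.Binary.PropositionalEquality
  using (_≡_; refl; sym; trans; cong; subst; subst₂)
open import Relation.Nullary using (yes; no; contradiction)
open import Function.Bundles using (_⇔_; mk⇔; module Equivalence)
open Equivalence using (to; from)

private variable n : ℕ

count : Subset n → ℕ → ℕ
count {n} X s = ∣ X ∩ seg n s ∣

count-zero : (X : Subset n) → count X 0 ≡ 0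
count-zero [] = refl
count-zero (true ∷ X) = count-zero X
count-zero (false ∷ X) = count-zero X

count-all : (X : Subset n) → count X n ≡ ∣ X ∣
count-all [] = refl
count-all (true ∷ X) = cong suc (count-all X)
count-all (false ∷ X) = count-all X

count≤∣X∣ : (X : Subset n) (s : ℕ) → count X s ≤ ∣ X ∣
count≤∣X∣ {n} X s = ∣p∩q∣≤∣p∣ X (seg n s)

count+count∁ : (X : Subset n) {s : ℕ} → s ≤ n → count X s + count (∁ X) s ≡ s
count+count∁ X {zero} _ rewrite count-zero X | count-zero (∁ X) = refl
count+count∁ (true ∷ X) {suc s} (s≤s s≤n) = cong suc (count+count∁ X s≤n)
count+count∁ (false ∷ X) {suc s} (s≤s s≤n) =
  trans (+-suc (count X s) (count (∁ X) s)) (cong suc (count+count∁ X s≤n))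

length-elems : (X : Subset n) → length (elems X) ≡ ∣ X ∣
length-elems [] = refl
length-elems (true ∷ X) = cong suc (trans (length-map suc (elems X)) (length-elems X))
length-elems (false ∷ X) = trans (length-map suc (elems X)) (length-elems X)

nth-map-suc : (l : List ℕ) (k : ℕ) → suc k ≤ length l →
              nth (map suc l) (suc k) ≡ suc (nth l (suc k))
nth-map-suc (x ∷ l) zero _ = refl
nth-map-suc (x ∷ l) (suc k) (s≤s k<len) = nth-map-suc l k k<len

m-tail : (X : Subset n) (k : ℕ) → suc k ≤ ∣ X ∣ →
         nth (map suc (elems X)) (suc k) ≡ suc (m X (suc k))
m-tail X k k<∣X∣ = nth-map-suc (elems X) k (subst (suc k ≤_) (sym (length-elems X)) k<∣X∣)

≤count⇒m≤ : (X : Subset n) (s k : ℕ) → suc k ≤ count X s → m X (suc k) ≤ s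
≤count⇒m≤ X zero k k<c rewrite count-zero X with () ← k<c
≤count⇒m≤ (true ∷ X) (suc s) zero _ = s≤s z≤n
≤count⇒m≤ (true ∷ X) (suc s) (suc k) (s≤s k<c)
  rewrite m-tail X k (≤-trans k<c (count≤∣X∣ X s)) = s≤s (≤count⇒m≤ X s k k<c)
≤count⇒m≤ (false ∷ X) (suc s) k k<c
  rewrite m-tail X k (≤-trans k<c (count≤∣X∣ X s)) = s≤s (≤count⇒m≤ X s k k<c)

count≤⇒<m : (X : Subset n) (s k : ℕ) → suc k ≤ ∣ X ∣ → count X s ≤ k → s < m X (suc k)
count≤⇒<m (true ∷ X) zero zero _ _ = s≤s z≤n
count≤⇒<m (true ∷ X) zero (suc k) (s≤s k<∣X∣) _ rewrite m-tail X k k<∣X∣ = s≤s z≤n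
count≤⇒<m (false ∷ X) zero k k<∣X∣ _ rewrite m-tail X k k<∣X∣ = s≤s z≤n
count≤⇒<m (true ∷ X) (suc s) (suc k) (s≤s k<∣X∣) (s≤s c≤k)
  rewrite m-tail X k k<∣X∣ = s≤s (count≤⇒<m X s k k<∣X∣ c≤k)
count≤⇒<m (false ∷ X) (suc s) k k<∣X∣ c≤k
  rewrite m-tail X k k<∣X∣ = s≤s (count≤⇒<m X s k k<∣X∣ c≤k)

0<m : (X : Subset n) (k : ℕ) → suc k ≤ ∣ X ∣ → 0 < m X (suc k)
0<m X k k<∣X∣ = count≤⇒<m X 0 k k<∣X∣ (subst (_≤ k) (sym (count-zero X)) z≤n)

m≤n : (X : Subset n) (k : ℕ) → suc k ≤ ∣ X ∣ → m X (suc k) ≤ n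
m≤n {n} X k k<∣X∣ = ≤count⇒m≤ X n k (subst (suc k ≤_) (sym (count-all X)) k<∣X∣)

≤count-m : (X : Subset n) (k : ℕ) → suc k ≤ ∣ X ∣ → suc k ≤ count X (m X (suc k))
≤count-m X k k<∣X∣ with suc k ≤? count X (m X (suc k))
... | yes k<c = k<c
... | no k≮c = contradiction (count≤⇒<m X _ k k<∣X∣ (≤-pred (≰⇒> k≮c))) (n≮n _)

<m⇒count≤ : (X : Subset n) (s k : ℕ) → s < m X (suc k) → count X s ≤ k
<m⇒count≤ X s k s<m with count X s ≤? k
... | yes c≤k = c≤k
... | no c≰k = contradiction (≤count⇒m≤ X s k (≰⇒> c≰k)) (<⇒≱ s<m)

+-shift-≤ : ∀ {x y s} z w → x + y ≡ s → s + z ≤ w + x ⇔ z + y ≤ w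
+-shift-≤ {x} {y} z w refl = mk⇔
  (λ le → +-cancelˡ-≤ x _ _ (subst₂ _≤_ reassoc (+-comm w x) le))
  (λ le → subst₂ _≤_ (sym reassoc) (+-comm x w) (+-monoʳ-≤ x le))
  where
  reassoc : x + y + z ≡ x + (z + y)
  reassoc = trans (+-assoc x y z) (cong (x +_) (+-comm y z))

segment-condition : (F G : Subset n) (s t : ℕ) → s ≤ n →
  s + t ≤ count F s + count G s ⇔ t + count (∁ G) s ≤ count F s
segment-condition F G s t s≤n = +-shift-≤ t (count F s) (count+count∁ G s≤n)

index-bound : ∀ t j a → t + j ≤ a ⇔ suc j ≤ a + 1 ∸ t
index-bound t j a rewrite +-comm a 1 = mk⇔
  (λ t+j≤a → m+n≤o⇒m≤o∸n (suc j) (s≤s (subst (_≤ a) (+-comm t j) t+j≤a)))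
  (λ j<a+1∸t → subst (_≤ a) (+-comm j t) (≤-pred (m≤o∸n⇒m+n≤o (suc j) (t≤1+a j<a+1∸t) j<a+1∸t)))
  where
  t≤1+a : suc j ≤ suc a ∸ t → t ≤ suc a
  t≤1+a j<a+1∸t = <⇒≤ (m∸n≢0⇒n<m λ a+1∸t≡0 → contradiction (subst (suc j ≤_) a+1∸t≡0 j<a+1∸t) λ ())

complement-room : ∀ {t j a b n} → t + j ≤ a → a + b < n + t → suc j ≤ n ∸ b
complement-room {t} {j} {a} {b} {n} t+j≤a a+b<n+t =
  m+n≤o⇒m≤o∸n (suc j) (+-cancelʳ-≤ t _ _ (begin
    suc j + b + t   ≡⟨ reorder j b t ⟩
    suc (t + j + b) ≤⟨ s≤s (+-monoˡ-≤ b t+j≤a) ⟩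
    suc (a + b)     ≤⟨ a+b<n+t ⟩
    n + t           ∎))
  where
  open ≤-Reasoning
  reorder : ∀ j b t → suc j + b + t ≡ suc (t + j + b)
  reorder = solve-∀

segment⇒gap : (F G : Subset n) (t′ s : ℕ) → ∣ F ∣ + ∣ G ∣ < n + suc t′ → s ≤ n →
  s + suc t′ ≤ count F s + count G s →
  ∃[ i ] (1 ≤ i × i ≤ ∣ F ∣ + 1 ∸ suc t′ × m (∁ G) i > m F (suc t′ + i ∸ 1))
segment⇒gap F G t′ s a+b<n+t s≤n excess =
  suc j , s≤s z≤n , to (index-bound (suc t′) j ∣ F ∣) t+j≤∣F∣ , gap
  where
  j = count (∁ G) s
  t+j≤cF : suc t′ + j ≤ count F s
  t+j≤cF = to (segment-condition F G s (suc t′) s≤n) excess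
  t+j≤∣F∣ : suc t′ + j ≤ ∣ F ∣
  t+j≤∣F∣ = ≤-trans t+j≤cF (count≤∣X∣ F s)
  j<∣∁G∣ : suc j ≤ ∣ ∁ G ∣
  j<∣∁G∣ rewrite ∣∁p∣≡n∸∣p∣ G = complement-room t+j≤∣F∣ a+b<n+t
  gap : m F (suc t′ + suc j ∸ 1) < m (∁ G) (suc j)
  gap rewrite +-suc t′ j =
    ≤-<-trans (≤count⇒m≤ F s (t′ + j) t+j≤cF) (count≤⇒<m (∁ G) s j j<∣∁G∣ ≤-refl)

gap⇒segment : (F G : Subset n) (t′ j : ℕ) → suc j ≤ ∣ F ∣ + 1 ∸ suc t′ →
  m F (suc t′ + suc j ∸ 1) < m (∁ G) (suc j) →
  ∃[ s ] (1 ≤ s × s ≤ n × s + suc t′ ≤ count F s + count G s)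
gap⇒segment F G t′ j bound gap =
  s , 0<m F k k<∣F∣ , s≤n , from (segment-condition F G s (suc t′) s≤n) t+c∁G≤cF
  where
  k = t′ + j
  k<∣F∣ : suc k ≤ ∣ F ∣
  k<∣F∣ = from (index-bound (suc t′) j ∣ F ∣) bound
  s = m F (suc k)
  s≤n = m≤n F k k<∣F∣
  c∁G≤j : count (∁ G) s ≤ j
  c∁G≤j = <m⇒count≤ (∁ G) s j (subst (λ i → m F i < m (∁ G) (suc j)) (+-suc t′ j) gap)
  t+c∁G≤cF : suc t′ + count (∁ G) s ≤ count F s
  t+c∁G≤cF = ≤-trans (+-monoʳ-≤ (suc t′) c∁G≤j) (≤count-m F k k<∣F∣)

lemma2 : (n a b t : ℕ) → 1 ≤ n → 1 ≤ t → a + b < n + t →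
    (F G : Subset n) → ∣ F ∣ ≡ a → ∣ G ∣ ≡ b →
    (∃[ s ] (1 ≤ s × s ≤ n × ∣ F ∩ seg n s ∣ + ∣ G ∩ seg n s ∣ ≥ s + t))
    ⇔ (∃[ i ] (1 ≤ i × i ≤ (a + 1) ∸ t × m (∁ G) i > m F (t + i ∸ 1)))
lemma2 n a b zero _ () _ F G _ _
lemma2 n a b (suc t′) _ _ a+b<n+t F G refl refl = mk⇔
  (λ (s , _ , s≤n , excess) → segment⇒gap F G t′ s a+b<n+t s≤n excess)
  (λ { (zero , () , _) ; (suc j , _ , bound , gap) → gap⇒segment F G t′ j bound gap })
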